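{- Let $m\ge 2$ and $n\ge m+1$. Then $\#PV(m;n)=\binom{n-1}{m-1}$.
   Context: For a permutation $\pi=a_1\ldots a_n$ of $\{1,\ldots,n\}$, an index $i$ is a peak if $a_{i-1}<a_i>a_{i+1}$ and a valley if $a_{i-1}>a_i<a_{i+1}$. $PV(\pi)$ is the set of all peaks and valleys of $\pi$. For $i_1<\cdots<i_s$, $PV(i_1,\ldots,i_s;n)$ is the set of permutations $\pi$ of $\{1,\ldots,n\}$ with $PV(\pi)=\{i_1,\ldots,i_s\}$ and $i_1$ a peak of $\pi$. -}

module Defs where

open import Data.Nat using (ℕ; zero; suc; _≤_; _<_; _∸_)
open import Data.List using (List; []; _∷_; length; map; upTo)
open import Data.Product using (_×_)
open import Data.Sum using (_⊎_)
open import Function.Bundles using (_⇔_)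
open import Relation.Binary.PropositionalEquality using (_≡_)
open import Data.List.Relation.Binary.Permutation.Propositional using (_↭_)

oneTo : ℕ → List ℕ
oneTo n = map suc (upTo n)

-- 0-based access with a dummy default (only ever used in range below).
at : List ℕ → ℕ → ℕ
at []       _       = 0
at (x ∷ xs) zero    = x
at (x ∷ xs) (suc i) = at xs i

-- 1-based entry a_i of π = a_1 … a_n.
entry : List ℕ → ℕ → ℕ
entry π i = at π (i ∸ 1)

IsPeak : List ℕ → ℕ → Set
IsPeak π i = (2 ≤ i) × (suc i ≤ length π)
           × (entry π (i ∸ 1) < entry π i) × (entry π (suc i) < entry π i)

IsValley : List ℕ → ℕ → Set
IsValley π i = (2 ≤ i) × (suc i ≤ length π)
             × (entry π i < entry π (i ∸ 1)) × (entry π i < entry π (suc i))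

InPV : List ℕ → ℕ → Set
InPV π i = IsPeak π i ⊎ IsValley π i

IsPerm : ℕ → List ℕ → Set
IsPerm n π = π ↭ oneTo n

InPVmn : ℕ → ℕ → List ℕ → Set
InPVmn m n π = IsPerm n π × (∀ i → InPV π i ⇔ (i ≡ m)) × IsPeak π m

module Submission where

-- A permutation π of [n] with PV(π) = {m} and m a peak is exactly a
-- *unimodal* permutation with summit at position m: strictly increasing on the
-- positions 1 … m and strictly decreasing on m … n.  Such permutations are counted
-- by following the entry 1: in a unimodal list the minimum sits at one of the two
-- ends.  Deleting it and lowering every other entry by one leaves a unimodal
-- permutation of [n-1] whose summit is at m-1 (1 was on the left) or at m (1 was
-- on the right), which is Pascal's recursion for C(n-1, m-1).

open import Defs
open import Data.Nat using (ℕ; zero; suc; pred; _≤_; _<_; _+_; _∸_; z≤n; s≤s)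
open import Data.Nat.Properties
  using (<-asym; <-cmp; <⇒≱; ≤⇒≯; ≤-antisym; ≤-pred; m≤n⇒m≤1+n; suc-injective; +-comm)
open import Data.Nat.Combinatorics using (_C_; nCk+nC[k+1]≡[n+1]C[k+1])
open import Data.List using (List; []; _∷_; [_]; _++_; _∷ʳ_; length; map; upTo)
open import Data.List.Properties
  using (map-upTo; length-map; length-upTo; length-++; map-injective; ∷ʳ-injectiveˡ; ∷-injectiveʳ)
open import Data.List.Relation.Unary.All using (All; []; _∷_)
import Data.List.Relation.Unary.All as All
import Data.List.Relation.Unary.All.Properties as AllProp
open import Data.List.Relation.Unary.AllPairs using ([]; _∷_)
import Data.List.Relation.Unary.AllPairs as AllPairs
open import Data.List.Relation.Unary.Any using (here; there)
open import Data.List.Membership.Propositional using (_∈_)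
open import Data.List.Membership.Propositional.Properties using (∈-map⁺; ∈-map⁻; ∈-++⁺ˡ; ∈-++⁺ʳ; ∈-++⁻)
open import Data.List.Relation.Unary.Unique.Propositional using (Unique)
import Data.List.Relation.Unary.Unique.Propositional.Properties as Unique
open import Data.List.Relation.Binary.Permutation.Propositional
  using (_↭_; prep; ↭-sym; ↭-reflexive; ↭-trans; ↭⇒↭ₛ)
open import Data.List.Relation.Binary.Permutation.Propositional.Properties
  using (All-resp-↭; ∈-resp-↭; ↭-length; ↭-singleton-inv; drop-∷; ∷↭∷ʳ)
import Data.List.Relation.Binary.Permutation.Propositional.Properties as Perm
open import Data.List.Relation.Binary.Permutation.Setoid.Properties using (Unique-resp-↭)
open import Data.Product using (Σ; _×_; _,_)
open import Data.Sum using (_⊎_; inj₁; inj₂)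
import Data.Sum as Sum
open import Data.Empty using (⊥-elim)
open import Relation.Nullary using (¬_)
open import Relation.Binary.PropositionalEquality
  using (_≡_; refl; sym; trans; cong; cong₂; subst₂; setoid; module ≡-Reasoning)
open import Relation.Binary.Definitions using (tri<; tri≈; tri>)
open import Function.Bundles using (_⇔_; mk⇔; Equivalence)
import Function.Properties.Equivalence as ⇔

data Descending : List ℕ → Set where
  single : ∀ {x} → Descending [ x ]
  step↓  : ∀ {x y ys} → y < x → Descending (y ∷ ys) → Descending (x ∷ y ∷ ys)

data Unimodal : ℕ → List ℕ → Set where
  summit : ∀ {x xs} → Descending (x ∷ xs) → Unimodal 1 (x ∷ xs)
  climb  : ∀ {p x y ys} → x < y → Unimodal p (y ∷ ys) → Unimodal (suc p) (x ∷ y ∷ ys)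

unimodal-pos : ∀ {p π} → Unimodal p π → 1 ≤ p
unimodal-pos (summit _)  = s≤s z≤n
unimodal-pos (climb _ _) = s≤s z≤n

peak-cons : ∀ {x xs i} → IsPeak xs i → IsPeak (x ∷ xs) (suc i)
peak-cons (s≤s (s≤s z≤n) , bound , rise , fall) = s≤s (s≤s z≤n) , s≤s bound , rise , fall

valley-cons : ∀ {x xs i} → IsValley xs i → IsValley (x ∷ xs) (suc i)
valley-cons (s≤s (s≤s z≤n) , bound , fall , rise) = s≤s (s≤s z≤n) , s≤s bound , fall , rise

peak-uncons : ∀ {x xs i} → 2 ≤ i → IsPeak (x ∷ xs) (suc i) → IsPeak xs i
peak-uncons (s≤s (s≤s z≤n)) (_ , s≤s bound , rise , fall) = s≤s (s≤s z≤n) , bound , rise , fall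

pv-cons : ∀ {x xs i} → InPV xs i → InPV (x ∷ xs) (suc i)
pv-cons = Sum.map peak-cons valley-cons

pv-index : ∀ {π i} → InPV π i → 2 ≤ i
pv-index (inj₁ (two≤i , _)) = two≤i
pv-index (inj₂ (two≤i , _)) = two≤i

PVWithin : List ℕ → ℕ → Set
PVWithin π p = ∀ i → InPV π i → i ≡ p

NoPV : List ℕ → Set
NoPV π = ∀ i → ¬ InPV π i

pv-tail : ∀ {x xs p} → PVWithin (x ∷ xs) (suc p) → PVWithin xs p
pv-tail within i h = suc-injective (within (suc i) (pv-cons h))

noPV-tail : ∀ {x xs} → NoPV (x ∷ xs) → NoPV xs
noPV-tail none i h = none (suc i) (pv-cons h)

descending-no-ascent : ∀ {π} → Descending π → ∀ j → ¬ (at π j < at π (suc j))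
descending-no-ascent single       zero    ()
descending-no-ascent single       (suc j) ()
descending-no-ascent (step↓ y<x _) zero    x<y = <-asym x<y y<x
descending-no-ascent (step↓ _ d)   (suc j) asc = descending-no-ascent d j asc

ascent-before-summit : ∀ {p π} → Unimodal p π → ∀ j → at π j < at π (suc j) → suc j < p
ascent-before-summit (summit d)  j       asc = ⊥-elim (descending-no-ascent d j asc)
ascent-before-summit (climb _ u) zero    _   = s≤s (unimodal-pos u)
ascent-before-summit (climb _ u) (suc j) asc = s≤s (ascent-before-summit u j asc)

descent-after-summit : ∀ {p π} → Unimodal p π → ∀ j → at π (suc j) < at π j → p ≤ suc j
descent-after-summit (summit _)    j       _   = s≤s z≤n
descent-after-summit (climb x<y _) zero    y<x = ⊥-elim (<-asym x<y y<x)
descent-after-summit (climb _ u)   (suc j) dsc = s≤s (descent-after-summit u j dsc)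

-- Hence the only possible peak or valley of a unimodal list is its summit:
-- a peak at i needs an ascent at i-2 and a descent at i-1, a valley the reverse.
unimodal-pv : ∀ {p π} → Unimodal p π → PVWithin π p
unimodal-pv u i (inj₁ (s≤s (s≤s z≤n) , _ , asc , dsc)) =
  ≤-antisym (ascent-before-summit u _ asc) (descent-after-summit u _ dsc)
unimodal-pv u i (inj₂ (s≤s (s≤s z≤n) , _ , dsc , asc)) =
  ⊥-elim (<⇒≱ (ascent-before-summit u _ asc) (m≤n⇒m≤1+n (descent-after-summit u _ dsc)))

unimodal-peak : ∀ {p π} → Unimodal p π → 2 ≤ p → suc p ≤ length π → IsPeak π p
unimodal-peak (summit _) (s≤s ()) _
unimodal-peak (climb x<y (summit (step↓ z<y _))) _ bound = s≤s (s≤s z≤n) , bound , x<y , z<y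
unimodal-peak (climb _ (summit single)) _ (s≤s (s≤s ()))
unimodal-peak (climb _ u@(climb _ v)) _ (s≤s bound) = peak-cons (unimodal-peak u (s≤s (unimodal-pos v)) bound)

-- Conversely: distinct entries, no peak or valley, and a first step down force
-- the whole list to descend (a later rise would create a valley).
descending-from : ∀ x y ys → Unique (x ∷ y ∷ ys) → y < x → NoPV (x ∷ y ∷ ys) → Descending (x ∷ y ∷ ys)
descending-from x y []       _ y<x _ = step↓ y<x single
descending-from x y (z ∷ zs) (_ ∷ distinct@((y≢z ∷ _) ∷ _)) y<x none with <-cmp y z
... | tri< y<z _ _ = ⊥-elim (none 2 (inj₂ (s≤s (s≤s z≤n) , s≤s (s≤s (s≤s z≤n)) , y<x , y<z)))
... | tri≈ _ y≡z _ = ⊥-elim (y≢z y≡z)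
... | tri> _ _ z<y = step↓ y<x (descending-from y z zs distinct z<y (noPV-tail {x} none))

-- A list of distinct entries whose only possible peak or valley is a peak at p is
-- unimodal with summit p: before p a descent would create a valley below p.
unimodal-from : ∀ {p π} → Unique π → PVWithin π p → IsPeak π p → Unimodal p π
unimodal-from {π = []} _ _ (_ , () , _)
unimodal-from {π = _ ∷ []} _ _ (s≤s (s≤s z≤n) , s≤s () , _)
unimodal-from {π = _ ∷ _ ∷ []} _ _ (s≤s (s≤s z≤n) , s≤s (s≤s ()) , _)
unimodal-from {suc zero} _ _ (s≤s () , _)
unimodal-from {suc (suc zero)} {x ∷ y ∷ z ∷ zs} (_ ∷ distinct) within (_ , _ , x<y , z<y) =
  climb x<y (summit (descending-from y z zs distinct z<y none))
  where
  none : NoPV (y ∷ z ∷ zs)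
  none i h with within (suc i) (pv-cons h) | pv-index h
  ... | refl | s≤s ()
unimodal-from {suc (suc (suc p))} {x ∷ y ∷ z ∷ zs} distinct@((x≢y ∷ _) ∷ _) within peak
  with unimodal-from {suc (suc p)} (AllPairs.tail distinct) (pv-tail {x} within) (peak-uncons {x} (s≤s (s≤s z≤n)) peak)
     | <-cmp x y
... | rest | tri< x<y _ _ = climb x<y rest
... | _    | tri≈ _ x≡y _ = ⊥-elim (x≢y x≡y)
... | climb y<z _ | tri> _ _ y<x
  with within 2 (inj₂ (s≤s (s≤s z≤n) , s≤s (s≤s (s≤s z≤n)) , y<x , y<z))
...   | ()

descending-map⁺ : ∀ {f} → (∀ {x y} → x < y → f x < f y) → ∀ {σ} → Descending σ → Descending (map f σ)
descending-map⁺ mono single       = single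
descending-map⁺ mono (step↓ lt d) = step↓ (mono lt) (descending-map⁺ mono d)

unimodal-map⁺ : ∀ {f} → (∀ {x y} → x < y → f x < f y) → ∀ {p σ} → Unimodal p σ → Unimodal p (map f σ)
unimodal-map⁺ mono (summit d)   = summit (descending-map⁺ mono d)
unimodal-map⁺ mono (climb lt u) = climb (mono lt) (unimodal-map⁺ mono u)

descending-map⁻ : ∀ {f} → (∀ {x y} → f x < f y → x < y) → ∀ σ → Descending (map f σ) → Descending σ
descending-map⁻ refl< (x ∷ [])     single       = single
descending-map⁻ refl< (x ∷ y ∷ ys) (step↓ lt d) = step↓ (refl< lt) (descending-map⁻ refl< (y ∷ ys) d)

unimodal-map⁻ : ∀ {f} → (∀ {x y} → f x < f y → x < y) → ∀ {p} σ → Unimodal p (map f σ) → Unimodal p σ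
unimodal-map⁻ refl< (x ∷ [])     (summit _)   = summit single
unimodal-map⁻ refl< (x ∷ y ∷ ys) (summit d)   = summit (descending-map⁻ refl< (x ∷ y ∷ ys) d)
unimodal-map⁻ refl< (x ∷ y ∷ ys) (climb lt u) = climb (refl< lt) (unimodal-map⁻ refl< (y ∷ ys) u)

descending-snoc : ∀ {τ a} → Descending τ → All (a <_) τ → Descending (τ ∷ʳ a)
descending-snoc single       (a<x ∷ []) = step↓ a<x single
descending-snoc (step↓ lt d) (_ ∷ as)   = step↓ lt (descending-snoc d as)

unimodal-snoc : ∀ {p τ a} → Unimodal p τ → All (a <_) τ → Unimodal p (τ ∷ʳ a)
unimodal-snoc (summit d)   as       = summit (descending-snoc d as)
unimodal-snoc (climb lt u) (_ ∷ as) = climb lt (unimodal-snoc u as)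

descending-unsnoc : ∀ x xs a → Descending ((x ∷ xs) ∷ʳ a) → Descending (x ∷ xs)
descending-unsnoc x []        a _            = single
descending-unsnoc x (x′ ∷ xs) a (step↓ lt d) = step↓ lt (descending-unsnoc x′ xs a d)

unimodal-unsnoc : ∀ {p} x xs a → Unimodal p ((x ∷ xs) ∷ʳ a) → All (a <_) (x ∷ xs) → Unimodal p (x ∷ xs)
unimodal-unsnoc x []        a (summit _)   _          = summit single
unimodal-unsnoc x []        a (climb x<a _) (a<x ∷ _) = ⊥-elim (<-asym x<a a<x)
unimodal-unsnoc x (x′ ∷ xs) a (summit d)   _          = summit (descending-unsnoc x (x′ ∷ xs) a d)
unimodal-unsnoc x (x′ ∷ xs) a (climb lt u) (_ ∷ as)   = climb lt (unimodal-unsnoc x′ xs a u as)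

descending-min-last : ∀ {π a} → Descending π → a ∈ π → All (a ≤_) π → Σ (List ℕ) (λ xs → π ≡ xs ∷ʳ a)
descending-min-last single (here refl) _ = [] , refl
descending-min-last (step↓ y<x _) (here refl) (_ ∷ a≤y ∷ _) = ⊥-elim (≤⇒≯ a≤y y<x)
descending-min-last {x ∷ _} (step↓ _ d) (there a∈) (_ ∷ as) with descending-min-last d a∈ as
... | xs , eq = x ∷ xs , cong (x ∷_) eq

unimodal-min-end : ∀ {p π a} → Unimodal p π → a ∈ π → All (a ≤_) π →
  Σ (List ℕ) (λ rest → π ≡ a ∷ rest) ⊎ Σ (List ℕ) (λ xs → π ≡ xs ∷ʳ a)
unimodal-min-end (summit d) a∈ as = inj₂ (descending-min-last d a∈ as)
unimodal-min-end (climb _ _) (here refl) _ = inj₁ (_ , refl)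
unimodal-min-end {π = x ∷ _} (climb x<y u) (there a∈) (a≤x ∷ as) with unimodal-min-end u a∈ as
... | inj₁ (_ , refl) = ⊥-elim (≤⇒≯ a≤x x<y)
... | inj₂ (xs , eq) = inj₂ (x ∷ xs , cong (x ∷_) eq)

oneTo-suc : ∀ n → oneTo (suc n) ≡ 1 ∷ map suc (oneTo n)
oneTo-suc n = cong (λ xs → 1 ∷ map suc xs) (sym (map-upTo suc n))

length-oneTo : ∀ n → length (oneTo n) ≡ n
length-oneTo n = trans (length-map suc (upTo n)) (length-upTo n)

perm-unique : ∀ {n π} → IsPerm n π → Unique π
perm-unique perm = Unique-resp-↭ (setoid ℕ) (↭⇒↭ₛ (↭-sym perm)) (Unique.map⁺ suc-injective (Unique.upTo⁺ _))

shifted-positive : ∀ ys → All (1 ≤_) (map suc ys)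
shifted-positive ys = AllProp.map⁺ (All.universal (λ _ → s≤s z≤n) ys)

perm-positive : ∀ {n π} → IsPerm n π → All (1 ≤_) π
perm-positive {n} perm = All-resp-↭ (↭-sym perm) (shifted-positive (upTo n))

perm-nonempty : ∀ {n} → ¬ IsPerm (suc n) []
perm-nonempty perm with ↭-length perm
... | ()

shift-above-one : ∀ {σ} → All (1 ≤_) σ → All (1 <_) (map suc σ)
shift-above-one pos = AllProp.map⁺ (All.map s≤s pos)

unshift : ∀ {rest ys} → rest ↭ map suc ys → Σ (List ℕ) (λ σ → (rest ≡ map suc σ) × (σ ↭ ys))
unshift {rest} {ys} perm =
  map pred rest ,
  sym (suc-pred (All-resp-↭ (↭-sym perm) (shifted-positive ys))) ,
  ↭-trans (Perm.map⁺ pred perm) (↭-reflexive (pred-suc ys))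
  where
  suc-pred : ∀ {xs} → All (1 ≤_) xs → map suc (map pred xs) ≡ xs
  suc-pred []             = refl
  suc-pred (s≤s z≤n ∷ ps) = cong (_ ∷_) (suc-pred ps)
  pred-suc : ∀ xs → map pred (map suc xs) ≡ xs
  pred-suc []       = refl
  pred-suc (x ∷ xs) = cong (x ∷_) (pred-suc xs)

extendLeft : List ℕ → List ℕ
extendLeft σ = 1 ∷ map suc σ

extendRight : List ℕ → List ℕ
extendRight σ = map suc σ ∷ʳ 1

extendLeft-perm : ∀ {n σ} → IsPerm n σ → IsPerm (suc n) (extendLeft σ)
extendLeft-perm {n} perm = ↭-trans (prep 1 (Perm.map⁺ suc perm)) (↭-reflexive (sym (oneTo-suc n)))

extendRight-perm : ∀ {n σ} → IsPerm n σ → IsPerm (suc n) (extendRight σ)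
extendRight-perm {σ = σ} perm = ↭-trans (↭-sym (∷↭∷ʳ 1 (map suc σ))) (extendLeft-perm perm)

extendLeft-perm⁻ : ∀ {n rest} → IsPerm (suc n) (1 ∷ rest) → Σ (List ℕ) (λ σ → (rest ≡ map suc σ) × IsPerm n σ)
extendLeft-perm⁻ {n} perm = unshift (drop-∷ (↭-trans perm (↭-reflexive (oneTo-suc n))))

extendRight-perm⁻ : ∀ {n xs} → IsPerm (suc n) (xs ∷ʳ 1) → Σ (List ℕ) (λ σ → (xs ≡ map suc σ) × IsPerm n σ)
extendRight-perm⁻ {xs = xs} perm = extendLeft-perm⁻ (↭-trans (∷↭∷ʳ 1 xs) perm)

extendLeft-unimodal : ∀ {n p σ} → IsPerm n σ → Unimodal p σ → Unimodal (suc p) (extendLeft σ)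
extendLeft-unimodal {σ = _ ∷ _} perm u with perm-positive perm
... | 1≤s ∷ _ = climb (s≤s 1≤s) (unimodal-map⁺ s≤s u)

extendRight-unimodal : ∀ {n p σ} → IsPerm n σ → Unimodal p σ → Unimodal p (extendRight σ)
extendRight-unimodal perm u = unimodal-snoc (unimodal-map⁺ s≤s u) (shift-above-one (perm-positive perm))

extendLeft-unimodal⁻ : ∀ {p s σ} → Unimodal (suc p) (extendLeft (s ∷ σ)) →
  Σ ℕ (λ p′ → (p ≡ suc p′) × Unimodal (suc p′) (s ∷ σ))
extendLeft-unimodal⁻ (summit (step↓ (s≤s ()) _))
extendLeft-unimodal⁻ {σ = []}    (climb _ u@(summit _))  = _ , refl , unimodal-map⁻ ≤-pred _ u
extendLeft-unimodal⁻ {σ = _ ∷ _} (climb _ u@(summit _))  = _ , refl , unimodal-map⁻ ≤-pred _ u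
extendLeft-unimodal⁻ {σ = _ ∷ _} (climb _ u@(climb _ _)) = _ , refl , unimodal-map⁻ ≤-pred _ u

extendRight-unimodal⁻ : ∀ {p s σ} → All (1 ≤_) (s ∷ σ) → Unimodal p (extendRight (s ∷ σ)) → Unimodal p (s ∷ σ)
extendRight-unimodal⁻ {s = s} {σ} pos u =
  unimodal-map⁻ ≤-pred (s ∷ σ) (unimodal-unsnoc (suc s) (map suc σ) 1 u (shift-above-one pos))

UnimodalPerm : ℕ → ℕ → List ℕ → Set
UnimodalPerm n p π = IsPerm n π × Unimodal p π

-- unimodalPerms k q lists the unimodal permutations of [k+1] with summit q+1,
-- sorted by the end at which the entry 1 sits (Pascal's recursion).
unimodalPerms : ℕ → ℕ → List (List ℕ)
unimodalPerms zero    zero    = [ [ 1 ] ]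
unimodalPerms zero    (suc q) = []
unimodalPerms (suc k) zero    = map extendRight (unimodalPerms k zero)
unimodalPerms (suc k) (suc q) = map extendLeft (unimodalPerms k q) ++ map extendRight (unimodalPerms k (suc q))

extendRight-∈ : ∀ k q {σ} → σ ∈ unimodalPerms k q → extendRight σ ∈ unimodalPerms (suc k) q
extendRight-∈ k zero    σ∈ = ∈-map⁺ extendRight σ∈
extendRight-∈ k (suc q) σ∈ = ∈-++⁺ʳ (map extendLeft (unimodalPerms k q)) (∈-map⁺ extendRight σ∈)

unimodalPerms-sound : ∀ k q {π} → π ∈ unimodalPerms k q → UnimodalPerm (suc k) (suc q) π
unimodalPerms-sound zero zero (here refl) = ↭-reflexive refl , summit single
unimodalPerms-sound (suc k) zero π∈ with ∈-map⁻ extendRight π∈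
... | σ , σ∈ , refl with unimodalPerms-sound k zero σ∈
...   | perm , u = extendRight-perm perm , extendRight-unimodal perm u
unimodalPerms-sound (suc k) (suc q) π∈ with ∈-++⁻ (map extendLeft (unimodalPerms k q)) π∈
... | inj₁ π∈ˡ with ∈-map⁻ extendLeft π∈ˡ
...   | σ , σ∈ , refl with unimodalPerms-sound k q σ∈
...     | perm , u = extendLeft-perm perm , extendLeft-unimodal perm u
unimodalPerms-sound (suc k) (suc q) π∈ | inj₂ π∈ʳ with ∈-map⁻ extendRight π∈ʳ
...   | σ , σ∈ , refl with unimodalPerms-sound k (suc q) σ∈
...     | perm , u = extendRight-perm perm , extendRight-unimodal perm u

unimodalPerms-complete : ∀ k q {π} → UnimodalPerm (suc k) (suc q) π → π ∈ unimodalPerms k q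
unimodalPerms-complete zero q (perm , u) with ↭-singleton-inv perm
unimodalPerms-complete zero zero    _        | refl = here refl
unimodalPerms-complete zero (suc q) (_ , ()) | refl
unimodalPerms-complete (suc k) q (perm , u)
  with unimodal-min-end u (∈-resp-↭ (↭-sym perm) (here refl)) (perm-positive perm)
... | inj₁ (_ , refl) with extendLeft-perm⁻ perm
...   | []    , refl , σperm = ⊥-elim (perm-nonempty σperm)
...   | s ∷ σ , refl , σperm with extendLeft-unimodal⁻ u
...     | q′ , refl , u′ =
  ∈-++⁺ˡ (∈-map⁺ extendLeft (unimodalPerms-complete k q′ (σperm , u′)))
unimodalPerms-complete (suc k) q (perm , u) | inj₂ (_ , refl) with extendRight-perm⁻ perm
...   | []    , refl , σperm = ⊥-elim (perm-nonempty σperm)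
...   | s ∷ σ , refl , σperm =
  extendRight-∈ k q (unimodalPerms-complete k q (σperm , extendRight-unimodal⁻ (perm-positive σperm) u))

unimodalPerms-members : ∀ k q π → (π ∈ unimodalPerms k q) ⇔ UnimodalPerm (suc k) (suc q) π
unimodalPerms-members k q π = mk⇔ (unimodalPerms-sound k q) (unimodalPerms-complete k q)

-- The two halves of the recursion never meet: extendLeft starts with 1, whereas
-- extendRight of a nonempty positive list starts with an entry ≥ 2.
left-right-disjoint : ∀ k q {π} → ¬ ((π ∈ map extendLeft (unimodalPerms k q)) × (π ∈ map extendRight (unimodalPerms k (suc q))))
left-right-disjoint k q (π∈ˡ , π∈ʳ) with ∈-map⁻ extendRight π∈ʳ
... | τ , τ∈ , refl with ∈-map⁻ extendLeft π∈ˡ | unimodalPerms-sound k (suc q) τ∈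
...   | σ , _ , eq | perm , climb _ _ with perm-positive perm | eq
...     | s≤s z≤n ∷ _ | ()

extendLeft-injective : ∀ {σ τ} → extendLeft σ ≡ extendLeft τ → σ ≡ τ
extendLeft-injective eq = map-injective suc-injective (∷-injectiveʳ eq)

extendRight-injective : ∀ {σ τ} → extendRight σ ≡ extendRight τ → σ ≡ τ
extendRight-injective {σ} {τ} eq = map-injective suc-injective (∷ʳ-injectiveˡ (map suc σ) (map suc τ) eq)

unimodalPerms-unique : ∀ k q → Unique (unimodalPerms k q)
unimodalPerms-unique zero    zero    = [] ∷ []
unimodalPerms-unique zero    (suc q) = []
unimodalPerms-unique (suc k) zero    = Unique.map⁺ extendRight-injective (unimodalPerms-unique k zero)
unimodalPerms-unique (suc k) (suc q) =
  Unique.++⁺ (Unique.map⁺ extendLeft-injective (unimodalPerms-unique k q))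
             (Unique.map⁺ extendRight-injective (unimodalPerms-unique k (suc q)))
             (left-right-disjoint k q)

length-unimodalPerms : ∀ k q → length (unimodalPerms k q) ≡ k C q
length-unimodalPerms zero    zero    = refl
length-unimodalPerms zero    (suc q) = refl
length-unimodalPerms (suc k) zero    =
  trans (length-map extendRight (unimodalPerms k zero)) (length-unimodalPerms k zero)
length-unimodalPerms (suc k) (suc q) = begin
  length (map extendLeft (unimodalPerms k q) ++ map extendRight (unimodalPerms k (suc q)))
    ≡⟨ length-++ (map extendLeft (unimodalPerms k q)) ⟩
  length (map extendLeft (unimodalPerms k q)) + length (map extendRight (unimodalPerms k (suc q)))
    ≡⟨ cong₂ _+_ (length-map extendLeft (unimodalPerms k q)) (length-map extendRight (unimodalPerms k (suc q))) ⟩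
  length (unimodalPerms k q) + length (unimodalPerms k (suc q))
    ≡⟨ cong₂ _+_ (length-unimodalPerms k q) (length-unimodalPerms k (suc q)) ⟩
  k C q + k C suc q
    ≡⟨ nCk+nC[k+1]≡[n+1]C[k+1] k q ⟩
  suc k C suc q ∎
  where open ≡-Reasoning

unimodal⇔PV : ∀ {m n π} → 2 ≤ m → m + 1 ≤ n → UnimodalPerm n m π ⇔ InPVmn m n π
unimodal⇔PV {m} {n} {π} 2≤m m+1≤n = mk⇔ to from
  where
  to : UnimodalPerm n m π → InPVmn m n π
  to (perm , u) = perm , (λ i → mk⇔ (unimodal-pv u i) λ { refl → inj₁ peak }) , peak
    where
    interior : suc m ≤ length π
    interior = subst₂ _≤_ (+-comm m 1) (sym (trans (↭-length perm) (length-oneTo n))) m+1≤n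
    peak : IsPeak π m
    peak = unimodal-peak u 2≤m interior
  from : InPVmn m n π → UnimodalPerm n m π
  from (perm , pv , peak) = perm , unimodal-from (perm-unique perm) (λ i → Equivalence.to (pv i)) peak

proposition7p2 : (m n : ℕ) → 2 ≤ m → m + 1 ≤ n →
    Σ (List (List ℕ)) (λ L →
    Unique L × (∀ π → (π ∈ L) ⇔ InPVmn m n π) × (length L ≡ (n ∸ 1) C (m ∸ 1)))
proposition7p2 (suc m′) (suc n′) 2≤m m+1≤n =
  unimodalPerms n′ m′ ,
  unimodalPerms-unique n′ m′ ,
  (λ π → ⇔.trans (unimodalPerms-members n′ m′ π) (unimodal⇔PV 2≤m m+1≤n)) ,
  length-unimodalPerms n′ m′
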